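{- Let $B$ be the bull. Then $rb(K_5,B) = 6$.
   Context: The bull $B$ is the unique graph with $5$ vertices and degree sequence $(1,1,2,3,3)$ (a triangle with pendant edges attached at two distinct vertices). For a graph $H$ and an integer $n$, the rainbow number $rb(K_n,H)$ is the minimum number $m$ such that every edge-colouring of $K_n$ using at least $m$ colours contains a rainbow copy of $H$ (a subgraph isomorphic to $H$ whose edges all have distinct colours). -}

module Defs where

open import Data.Nat using (ℕ; _≤_; _<_)
import Data.Nat as ℕ
open import Data.Fin using (Fin; toℕ)
open import Data.Fin.Patterns
open import Data.List using (List; []; _∷_; allFin; concatMap; filter; map; length; deduplicate)
open import Data.List.Relation.Unary.AllPairs using (AllPairs)
open import Data.Product using (Σ; _×_; _,_; proj₁; proj₂)
open import Function using (_∘_)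
open import Function.Definitions using (Injective)
open import Relation.Binary.PropositionalEquality using (_≡_; _≢_)
open import Relation.Nullary using (¬_)

-- An edge-colouring of the complete graph K_n on vertex set Fin n:
-- a symmetric assignment of a colour (a natural number) to each pair
-- of vertices; only the values on pairs of distinct vertices matter.
EdgeColouring : ℕ → Set
EdgeColouring n = Σ (Fin n → Fin n → ℕ) λ c → ∀ i j → c i j ≡ c j i

edges : (n : ℕ) → List (Fin n × Fin n)
edges n = concatMap (λ i → map (i ,_) (filter (λ j → toℕ i ℕ.<? toℕ j) (allFin n))) (allFin n)

numColours : (n : ℕ) → EdgeColouring n → ℕ
numColours n (c , _) = length (deduplicate ℕ._≟_ (map (λ e → c (proj₁ e) (proj₂ e)) (edges n)))

bullEdges : List (Fin 5 × Fin 5)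
bullEdges = (0F , 1F) ∷ (1F , 2F) ∷ (0F , 2F) ∷ (0F , 3F) ∷ (1F , 4F) ∷ []

HasRainbowBull : (n : ℕ) → EdgeColouring n → Set
HasRainbowBull n (c , _) =
  Σ (Fin 5 → Fin n) λ f → Injective _≡_ _≡_ f ×
    AllPairs _≢_ (map (λ e → c (f (proj₁ e)) (f (proj₂ e))) bullEdges)

RainbowForces : ℕ → ℕ → Set
RainbowForces n m = (c : EdgeColouring n) → m ≤ numColours n c → HasRainbowBull n c

RainbowNumberBull : ℕ → ℕ → Set
RainbowNumberBull n r = RainbowForces n r × (∀ m → RainbowForces n m → r ≤ m)

-- Up to renaming of colours, an edge-colouring of K₅ is a partition of its ten
-- edges into colour classes.  The upper bound searches all such partitions,
-- building them edge by edge: each new edge joins a class met before or opens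
-- a new one.  A branch is closed as soon as some bull has its five edges in
-- five different classes, or when at most five classes remain possible.  That
-- every branch closes is checked by evaluation; for an arbitrary colouring
-- one then follows the branch its own colour classes determine.  For the lower
-- bound, a K₄ in one colour plus four new colours on the edges at the fifth
-- vertex uses five colours, and every bull repeats the colour of the K₄.

module Submission where

open import Defs
open import Data.Bool using (Bool; T; true; false; not; _∧_; _∨_; if_then_else_)
open import Data.Bool.ListAction using (all; any)
open import Data.Bool.Properties using (T-∧; T-∨; T-≡)
open import Data.Empty using (⊥-elim)
open import Data.Fin using (Fin; toℕ)
open import Data.Fin.Patterns
open import Data.Fin.Properties using (all?) renaming (_≟_ to _≟ᶠ_)
open import Data.List using (List; []; _∷_; map; length; deduplicate; upTo; partitionᵇ; mapMaybe; cartesianProductWith; allFin; _++_)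
open import Data.List.Properties using (length-++; length-map; length-upTo; length-removeAt′; map-cong)
open import Data.List.Membership.Propositional using (_∈_; find; lose)
open import Data.List.Membership.Propositional.Properties using (∈-map⁺; ∈-map⁻; ∈-++⁺ˡ; ∈-++⁺ʳ; ∈-upTo⁺; ∈-upTo⁻; ∈-deduplicate⁻)
open import Data.List.Relation.Binary.Subset.Propositional using (_⊆_)
import Data.List.Relation.Unary.All as All
open import Data.List.Relation.Unary.All.Properties using (all⁺)
open import Data.List.Relation.Unary.AllPairs as AllPairs using (AllPairs; []; _∷_; allPairs?)
open import Data.List.Relation.Unary.AllPairs.Properties using (map⁺; map⁻)
open import Data.List.Relation.Unary.Any as Any using (here; there; any?; index; _─_)
open import Data.List.Relation.Unary.Any.Properties using (any⁻)
open import Data.List.Relation.Unary.Unique.Propositional using (Unique)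
open import Data.Maybe as Maybe using (Maybe; just; nothing)
open import Data.Maybe.Properties using (just-injective)
open import Data.Nat using (ℕ; zero; suc; _+_; _≤_; _<_; z≤n; s≤s; _<ᵇ_; _≡ᵇ_; _≤?_)
open import Data.Nat.Properties using (_≟_; <-irrefl; ≤-trans; ≤-<-trans; n<1+n; m<n⇒m<1+n; m<1+n⇒m<n∨m≡n; <⇒≢; <ᵇ⇒<; ≡⇒≡ᵇ; ≤-pred; ≰⇒>; module ≤-Reasoning)
open import Data.List.Relation.Unary.Unique.DecPropositional.Properties _≟_ using (deduplicate-!)
open import Data.Product using (Σ; ∃; _×_; _,_; proj₁; proj₂; uncurry)
open import Data.Product.Properties using (,-injective)
open import Data.Sum using (_⊎_; inj₁; inj₂)
open import Data.Vec using (Vec; lookup) renaming ([] to []ᵥ; _∷_ to _∷ᵥ_)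
import Data.Vec.Relation.Unary.AllPairs as VecAllPairs
open import Data.Vec.Relation.Unary.Unique.Propositional using () renaming (Unique to UniqueVec)
open import Data.Vec.Relation.Unary.Unique.Propositional.Properties using (lookup-injective)
open import Function.Base using (_∘_)
open import Function.Bundles using (Equivalence)
open import Relation.Binary.Definitions using (DecidableEquality)
open import Relation.Binary.PropositionalEquality using (_≡_; _≢_; refl; sym; trans; cong; cong₂; subst)
open import Relation.Nullary using (¬_; yes; no; does)
open import Relation.Nullary.Decidable using (¬?; _×-dec_; dec⇒maybe; map′; toWitness)

∈-─⁺ : {A : Set} {x z : A} {ys : List A} (x∈ys : x ∈ ys) → z ∈ ys → z ≢ x → z ∈ (ys ─ x∈ys)
∈-─⁺ (here refl) (here refl) z≢x = ⊥-elim (z≢x refl)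
∈-─⁺ (here _)    (there z∈ys) _  = z∈ys
∈-─⁺ (there _)   (here z≡y) _    = here z≡y
∈-─⁺ (there x∈ys) (there z∈ys) z≢x = there (∈-─⁺ x∈ys z∈ys z≢x)

unique-⊆⇒length≤ : {A : Set} {xs ys : List A} → Unique xs → xs ⊆ ys → length xs ≤ length ys
unique-⊆⇒length≤ {xs = []} _ _ = z≤n
unique-⊆⇒length≤ {xs = x ∷ xs} {ys} (x∉xs ∷ xs!) xs⊆ys = begin
  suc (length xs)          ≤⟨ s≤s (unique-⊆⇒length≤ xs! xs⊆ys─x) ⟩
  suc (length (ys ─ x∈ys)) ≡⟨ sym (length-removeAt′ ys (index x∈ys)) ⟩
  length ys                ∎
  where
  open ≤-Reasoning
  x∈ys = xs⊆ys (here refl)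
  xs⊆ys─x : xs ⊆ (ys ─ x∈ys)
  xs⊆ys─x z∈xs = ∈-─⁺ x∈ys (xs⊆ys (there z∈xs)) (λ z≡x → All.lookup x∉xs z∈xs (sym z≡x))

module _ {D B : Set} (_≟ᴰ_ : DecidableEquality D) where

  update : (D → B) → D → B → D → B
  update f d b d′ = if does (d′ ≟ᴰ d) then b else f d′

  update-≡ : ∀ f d b → update f d b d ≡ b
  update-≡ f d b with d ≟ᴰ d
  ... | yes _ = refl
  ... | no d≢d = ⊥-elim (d≢d refl)

  update-≢ : ∀ f {d d′} b → d′ ≢ d → update f d b d′ ≡ f d′
  update-≢ f {d} {d′} b d′≢d with d′ ≟ᴰ d
  ... | yes d′≡d = ⊥-elim (d′≢d d′≡d)
  ... | no _ = refl

_[_↦_] : (ℕ → ℕ) → ℕ → ℕ → ℕ → ℕ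
y [ m ↦ v ] = update _≟_ y m v

pairwise : {B : Set} → (B → B → Bool) → List B → Bool
pairwise p [] = true
pairwise p (b ∷ bs) = all (p b) bs ∧ pairwise p bs

pairwise⁻ : {B : Set} (p : B → B → Bool) (bs : List B) → T (pairwise p bs) → AllPairs (λ a b → T (p a b)) bs
pairwise⁻ p [] _ = []
pairwise⁻ p (b ∷ bs) t with Equivalence.to T-∧ t
... | head , tail = all⁺ (p b) bs head ∷ pairwise⁻ p bs tail

not≡ᵇ⇒≢ : ∀ m n → T (not (m ≡ᵇ n)) → m ≢ n
not≡ᵇ⇒≢ m n t m≡n = subst (T ∘ not) (Equivalence.to T-≡ (≡⇒≡ᵇ m n m≡n)) t

InjectiveBelow : ℕ → (ℕ → ℕ) → Set
InjectiveBelow m y = ∀ {a b} → a < m → b < m → y a ≡ y b → a ≡ b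

injectiveBelow-extend : ∀ {m y v} → InjectiveBelow m y → (∀ {l} → l < m → v ≢ y l) →
                        InjectiveBelow (suc m) (y [ m ↦ v ])
injectiveBelow-extend {m} {y} {v} inj fresh {a} {b} a<1+m b<1+m
  with m<1+n⇒m<n∨m≡n a<1+m | m<1+n⇒m<n∨m≡n b<1+m
... | inj₂ refl | inj₂ refl = λ _ → refl
... | inj₂ refl | inj₁ b<m
  rewrite update-≡ _≟_ y a v | update-≢ _≟_ y v (<⇒≢ b<m) = λ v≡yb → ⊥-elim (fresh b<m v≡yb)
... | inj₁ a<m | inj₂ refl
  rewrite update-≡ _≟_ y b v | update-≢ _≟_ y v (<⇒≢ a<m) = λ ya≡v → ⊥-elim (fresh a<m (sym ya≡v))
... | inj₁ a<m | inj₁ b<m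
  rewrite update-≢ _≟_ y v (<⇒≢ a<m) | update-≢ _≟_ y v (<⇒≢ b<m) = inj a<m b<m

module PartitionSearch
  {E A : Set} (_≟ᴱ_ : DecidableEquality E) (slots : A → List E) (K : ℕ) where

  open import Data.List.Membership.DecPropositional _≟ᴱ_ using (_∈?_)

  Rainbow : (E → ℕ) → A → Set
  Rainbow x a = AllPairs _≢_ (map x (slots a))

  Labelling : Set
  Labelling = E → Maybe ℕ

  _[_≔_] : Labelling → E → ℕ → Labelling
  lab [ e ≔ l ] = update _≟ᴱ_ lab e (just l)

  apart : Maybe ℕ → Maybe ℕ → Bool
  apart (just l) (just l′) = not (l ≡ᵇ l′)
  apart _ _ = false

  distinctlyLabelled : Labelling → A → Bool
  distinctlyLabelled lab a = pairwise apart (map lab (slots a))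

  -- Soundness below holds for every schedule; this one tests each target
  -- exactly once, when the last of its slots receives a label.
  Schedule : Set
  Schedule = List (E × List A)

  scheduleFrom : List E → List E → List A → Schedule
  scheduleFrom done [] _ = []
  scheduleFrom done (e ∷ es) as =
    let ready , waiting = partitionᵇ (λ a → all (λ s → does (s ∈? e ∷ done)) (slots a)) as
    in (e , ready) ∷ scheduleFrom (e ∷ done) es waiting

  schedule : List E → List A → Schedule
  schedule = scheduleFrom []

  map-proj₁-scheduleFrom : ∀ done es as → map proj₁ (scheduleFrom done es as) ≡ es
  map-proj₁-scheduleFrom done [] as = refl
  map-proj₁-scheduleFrom done (e ∷ es) as = cong (e ∷_) (map-proj₁-scheduleFrom (e ∷ done) es _)

  -- covered rest m lab: however the slots of rest join the m classes met so far
  -- or open new ones, either fewer than K classes arise (there are at most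
  -- m + length rest) or some target gets pairwise distinct labels.
  mutual
    covered : Schedule → ℕ → Labelling → Bool
    covered rest m lab = (m + length rest <ᵇ K) ∨ branches rest m lab

    branches : Schedule → ℕ → Labelling → Bool
    branches [] _ _ = false
    branches ((e , as) ∷ rest) m lab =
      all (λ l → extends as rest m (lab [ e ≔ l ])) (upTo m) ∧ extends as rest (suc m) (lab [ e ≔ m ])

    extends : List A → Schedule → ℕ → Labelling → Bool
    extends as rest m lab = any (distinctlyLabelled lab) as ∨ covered rest m lab

  relabel : ∀ {lab e l s l′} → (lab [ e ≔ l ]) s ≡ just l′ → (s ≡ e × l′ ≡ l) ⊎ lab s ≡ just l′
  relabel {e = e} {s = s} eq with s ≟ᴱ e
  ... | yes refl = inj₁ (refl , sym (just-injective eq))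
  ... | no _ = inj₂ eq

  Labelled : Labelling → E → Set
  Labelled lab s = ∃ λ l → lab s ≡ just l

  labelled-step : ∀ {lab e es l s} → Labelled lab s ⊎ s ∈ e ∷ es → Labelled (lab [ e ≔ l ]) s ⊎ s ∈ es
  labelled-step {lab} {e} {l = l} {s} p with s ≟ᴱ e | p
  ... | yes _   | _                 = inj₁ (l , refl)
  ... | no _    | inj₁ labelled     = inj₁ labelled
  ... | no s≢e  | inj₂ (here s≡e)   = ⊥-elim (s≢e s≡e)
  ... | no _    | inj₂ (there s∈es) = inj₂ s∈es

  module Soundness (es : List E) (as : List A) (x : E → ℕ) where

    -- The labels number the colour classes met so far and y names their colours.
    record Represents (rest : Schedule) (m : ℕ) (lab : Labelling) (y : ℕ → ℕ) : Set where
      field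
        label<      : ∀ {s l} → lab s ≡ just l → l < m
        colour≡     : ∀ {s l} → lab s ≡ just l → x s ≡ y l
        y-injective : InjectiveBelow m y
        covers      : ∀ {s} → s ∈ es → Labelled lab s ⊎ s ∈ map proj₁ rest

    open Represents

    initial : Represents (schedule es as) 0 (λ _ → nothing) (λ _ → 0)
    initial .label< ()
    initial .colour≡ ()
    initial .y-injective ()
    initial .covers {s} s∈es = inj₂ (subst (s ∈_) (sym (map-proj₁-scheduleFrom [] es as)) s∈es)

    module _ {rest m lab y} (r : Represents rest m lab y) where

      apart⇒distinct : ∀ {s s′} → T (apart (lab s) (lab s′)) → x s ≢ x s′
      apart⇒distinct {s} {s′} l≢l′ with lab s in eq | lab s′ in eq′
      ... | just l | just l′ = λ xs≡xs′ → not≡ᵇ⇒≢ l l′ l≢l′ (y-injective r (label< r eq) (label< r eq′)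
                                  (trans (sym (colour≡ r eq)) (trans xs≡xs′ (colour≡ r eq′))))

      distinctlyLabelled⇒rainbow : ∀ {a} → T (distinctlyLabelled lab a) → Rainbow x a
      distinctlyLabelled⇒rainbow t = map⁺ (AllPairs.map apart⇒distinct (map⁻ (pairwise⁻ apart _ t)))

      colours⊆ : map x es ⊆ map y (upTo m) ++ map x (map proj₁ rest)
      colours⊆ z∈ with ∈-map⁻ x z∈
      ... | s , s∈es , refl with covers r s∈es
      ...   | inj₁ (l , eq) rewrite colour≡ r eq = ∈-++⁺ˡ (∈-map⁺ y (∈-upTo⁺ (label< r eq)))
      ...   | inj₂ s∈rest = ∈-++⁺ʳ (map y (upTo m)) (∈-map⁺ x s∈rest)

      colours≤ : length (deduplicate _≟_ (map x es)) ≤ m + length rest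
      colours≤ = subst (_ ≤_) length-colours
        (unique-⊆⇒length≤ (deduplicate-! (map x es)) (colours⊆ ∘ ∈-deduplicate⁻ _≟_ (map x es)))
        where
        length-colours : length (map y (upTo m) ++ map x (map proj₁ rest)) ≡ m + length rest
        length-colours rewrite length-++ (map y (upTo m)) {map x (map proj₁ rest)}
                             | length-map y (upTo m) | length-upTo m
                             | length-map x (map proj₁ rest) | length-map proj₁ rest = refl

    module _ {e as′ rest m lab y} (r : Represents ((e , as′) ∷ rest) m lab y) where

      represents-seen : ∀ {l} → l < m → x e ≡ y l → Represents rest m (lab [ e ≔ l ]) y
      represents-seen {l} l<m xe≡yl .label< eq with relabel {lab} {e} {l} eq
      ... | inj₁ (refl , refl) = l<m
      ... | inj₂ eq′ = label< r eq′
      represents-seen {l} l<m xe≡yl .colour≡ eq with relabel {lab} {e} {l} eq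
      ... | inj₁ (refl , refl) = xe≡yl
      ... | inj₂ eq′ = colour≡ r eq′
      represents-seen l<m xe≡yl .y-injective = y-injective r
      represents-seen l<m xe≡yl .covers s∈es = labelled-step {lab} {e} (covers r s∈es)

      represents-fresh : (∀ {l} → l < m → x e ≢ y l) → Represents rest (suc m) (lab [ e ≔ m ]) (y [ m ↦ x e ])
      represents-fresh fresh .label< eq with relabel {lab} {e} {m} eq
      ... | inj₁ (refl , refl) = n<1+n m
      ... | inj₂ eq′ = m<n⇒m<1+n (label< r eq′)
      represents-fresh fresh .colour≡ eq with relabel {lab} {e} {m} eq
      ... | inj₁ (refl , refl) = sym (update-≡ _≟_ y m (x e))
      ... | inj₂ eq′ = trans (colour≡ r eq′) (sym (update-≢ _≟_ y (x e) (<⇒≢ (label< r eq′))))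
      represents-fresh fresh .y-injective = injectiveBelow-extend (y-injective r) fresh
      represents-fresh fresh .covers s∈es = labelled-step {lab} {e} (covers r s∈es)

    module _ (enough : K ≤ length (deduplicate _≟_ (map x es))) where

      mutual
        covered-sound : ∀ {rest m lab y} → Represents rest m lab y → T (covered rest m lab) → ∃ (Rainbow x)
        covered-sound {rest} {m} r t with Equivalence.to T-∨ t
        ... | inj₁ few = ⊥-elim (<-irrefl refl
                           (≤-<-trans (≤-trans enough (colours≤ r)) (<ᵇ⇒< (m + length rest) K few)))
        ... | inj₂ b = branches-sound r b

        branches-sound : ∀ {rest m lab y} → Represents rest m lab y → T (branches rest m lab) → ∃ (Rainbow x)
        branches-sound {(e , as′) ∷ rest} {m} {lab} {y} r t
          with Equivalence.to T-∧ t | any? (λ l → x e ≟ y l) (upTo m)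
        ... | seen-ok , _ | yes seen with l , l∈ , xe≡yl ← find seen =
          extends-sound {as′} (represents-seen r (∈-upTo⁻ l∈) xe≡yl) (All.lookup (all⁺ _ (upTo m) seen-ok) l∈)
        ... | _ , fresh-ok | no unseen =
          extends-sound {as′} (represents-fresh r (λ l<m xe≡yl → unseen (lose (∈-upTo⁺ l<m) xe≡yl))) fresh-ok

        extends-sound : ∀ {as′ rest m lab y} → Represents rest m lab y → T (extends as′ rest m lab) → ∃ (Rainbow x)
        extends-sound {as′} {lab = lab} r t with Equivalence.to T-∨ t
        ... | inj₁ found with a , d ← Any.satisfied (any⁻ (distinctlyLabelled lab) as′ found) =
          a , distinctlyLabelled⇒rainbow r d
        ... | inj₂ c = covered-sound r c

  SearchSucceeds : List E → List A → Set
  SearchSucceeds es as = covered (schedule es as) 0 (λ _ → nothing) ≡ true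

  searchSucceeds⇒rainbow : ∀ es as → SearchSucceeds es as →
           ∀ x → K ≤ length (deduplicate _≟_ (map x es)) → ∃ (Rainbow x)
  searchSucceeds⇒rainbow es as search x enough =
    Soundness.covered-sound es as x enough (Soundness.initial es as x) (Equivalence.from T-≡ search)

-- Propositionally equal to ≡-dec _≟ᶠ_ _≟ᶠ_, but computing its verdict does
-- not force the equality proofs, which keeps the search fast.
_≟ᵉ_ : DecidableEquality (Fin 5 × Fin 5)
(i , j) ≟ᵉ (k , l) = map′ (uncurry (cong₂ _,_)) ,-injective ((i ≟ᶠ k) ×-dec (j ≟ᶠ l))

sortedEdge : Fin 5 → Fin 5 → Fin 5 × Fin 5
sortedEdge i j = if toℕ i <ᵇ toℕ j then (i , j) else (j , i)

colour-sortedEdge : (c : Fin 5 → Fin 5 → ℕ) → (∀ i j → c i j ≡ c j i) →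
                    ∀ i j → c (proj₁ (sortedEdge i j)) (proj₂ (sortedEdge i j)) ≡ c i j
colour-sortedEdge c c-sym i j with toℕ i <ᵇ toℕ j
... | true = refl
... | false = c-sym j i

vectors : ∀ {m} n → List (Vec (Fin m) n)
vectors zero = []ᵥ ∷ []
vectors (suc n) = cartesianProductWith _∷ᵥ_ (allFin _) (vectors n)

BullEmbedding : Set
BullEmbedding = Σ (Vec (Fin 5) 5) UniqueVec

-- The automorphism 0 ↔ 1, 3 ↔ 4 of the bull pairs up its embeddings, so
-- those with f 0 < f 1 already meet every copy of the bull.
bullEmbeddings : List BullEmbedding
bullEmbeddings = mapMaybe embedding (vectors 5)
  where
  embedding : Vec (Fin 5) 5 → Maybe BullEmbedding
  embedding v = if toℕ (lookup v 0F) <ᵇ toℕ (lookup v 1F)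
    then Maybe.map (v ,_) (dec⇒maybe (VecAllPairs.allPairs? (λ i j → ¬? (i ≟ᶠ j)) v))
    else nothing

bullSlots : BullEmbedding → List (Fin 5 × Fin 5)
bullSlots (v , _) = map (λ e → sortedEdge (lookup v (proj₁ e)) (lookup v (proj₂ e))) bullEdges

open PartitionSearch _≟ᵉ_ bullSlots 6

-- As an equation checked by refl, this is evaluated much faster than a
-- witness of T would be.
bullSearch : SearchSucceeds (edges 5) bullEmbeddings
bullSearch = refl

rainbow⇒rainbowBull : ((c , c-sym) : EdgeColouring 5) (b : BullEmbedding) →
                      Rainbow (λ e → c (proj₁ e) (proj₂ e)) b → HasRainbowBull 5 (c , c-sym)
rainbow⇒rainbowBull (c , c-sym) (v , v!) rainbow =
  lookup v , (λ {i} {j} → lookup-injective v! i j) ,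
  subst (AllPairs _≢_)
        (map-cong (λ e → colour-sortedEdge c c-sym (lookup v (proj₁ e)) (lookup v (proj₂ e))) bullEdges)
        rainbow

sixColoursForceRainbowBull : RainbowForces 5 6
sixColoursForceRainbowBull (c , c-sym) enough =
  uncurry (rainbow⇒rainbowBull (c , c-sym))
          (searchSucceeds⇒rainbow (edges 5) bullEmbeddings bullSearch (λ e → c (proj₁ e) (proj₂ e)) enough)

extremalColour : Fin 5 → Fin 5 → ℕ
extremalColour 4F j = suc (toℕ j)
extremalColour i 4F = suc (toℕ i)
extremalColour _ _ = 0

extremalColouring : EdgeColouring 5
extremalColouring =
  extremalColour , toWitness {a? = all? λ i → all? λ j → extremalColour i j ≟ extremalColour j i} _

noRainbowBull : ¬ HasRainbowBull 5 extremalColouring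
noRainbowBull (f , _ , rainbow) = noRainbowQuintuple (f 0F) (f 1F) (f 2F) (f 3F) (f 4F) rainbow
  where
  noRainbowQuintuple : ∀ a b c d e → ¬ AllPairs _≢_
    (extremalColour a b ∷ extremalColour b c ∷ extremalColour a c ∷ extremalColour a d ∷ extremalColour b e ∷ [])
  noRainbowQuintuple = toWitness {a? = all? λ a → all? λ b → all? λ c → all? λ d → all? λ e →
    ¬? (allPairs? (λ u v → ¬? (u ≟ v)) _)} _

rainbowForces⇒6≤ : ∀ m → RainbowForces 5 m → 6 ≤ m
rainbowForces⇒6≤ m forces with 6 ≤? m
... | yes 6≤m = 6≤m
... | no 6≰m = ⊥-elim (noRainbowBull (forces extremalColouring (≤-pred (≰⇒> 6≰m))))

proposition1 : RainbowNumberBull 5 6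
proposition1 = sixColoursForceRainbowBull , rainbowForces⇒6≤
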